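{- Let $n\ge3$. The map $m$ sends every configuration that is recurrent for the SSM on $W_n$ to a configuration that is minimal recurrent for the SSM on $W_n$; as a map from the set of SSM-recurrent configurations to the set of SSM-minimal recurrent configurations it is surjective and restricts to the identity on the minimal recurrent configurations. Moreover, for every SSM-recurrent configuration $c$ on $W_n$, $\mathrm{level}(c)=|c|-|m(c)|$, where $|c|:=\sum_{i=1}^n c_i$.
   Context: $C_n$ has vertex set $[n]$ and edges $\{i,i+1\}$ ($i\in[n-1]$) and $\{n,1\}$; vertices are indexed modulo $n$, arranged clockwise. $W_n$ has vertex set $\{0,\dots,n\}$, the edges of $C_n$, and edges $\{0,i\}$ for all $i\in[n]$; $0$ is the sink. For $i\neq j$, $(i,j)$ denotes the vertices strictly between $i$ and $j$ going clockwise from $i$. Stochastic sandpile model (SSM) with parameter $p\in(0,1)$ on $W_n$: a configuration is $c\in\mathbb{Z}_{\ge0}^n$, stable if $c_i<3$ for all $i$; toppling an unstable $i$ sends, for each neighbour $j$ independently, one grain from $i$ to $j$ with probability $p$ (lost if $j=0$), else keeps it; repeated toppling stabilises. With a distribution $\mu$ on $[n]$, all $\mu_i>0$, the Markov chain on stable configurations adds a grain at $i$ with probability $\mu_i$ and stabilises; recurrent configurations are its recurrent states; minimal recurrent ones are those minimal for the pointwise order among recurrent ones. The level of $c$ is $\sum_ic_i+\deg(0)-|E(W_n)|=\sum_ic_i-n$. For recurrent $c$, a vertex $i$ is a cyclically first maximal vertex if $c_i=2$ and there is $j\in[n]$ with $c_j=0$ and $c_k=1$ for all $k\in(j,i)$.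 Then $m(c)_i=0$ if $c_i=0$, $m(c)_i=2$ if $i$ is a cyclically first maximal vertex, and $m(c)_i=1$ otherwise. -}

module Defs where

open import Data.Nat using (ℕ; zero; suc; _+_; _*_; _≤_; _<ᵇ_; _≟_)
open import Data.Nat.DivMod using (_%_; m%n<n)
open import Data.Bool using (Bool; true; false; if_then_else_; _∧_; _∨_; T)
open import Data.Fin using (Fin; toℕ; fromℕ<) renaming (_≟_ to _≟ᶠ_)
open import Data.Fin.Properties using (any?; all?)
open import Data.Vec using (Vec; lookup; tabulate; sum)
open import Data.Integer using (ℤ; +_) renaming (_-_ to _-ℤ_)
open import Data.Product using (Σ; ∃; _×_; _,_)
open import Relation.Binary.PropositionalEquality using (_≡_)
open import Relation.Binary.Construct.Closure.ReflexiveTransitive using (Star)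
open import Relation.Nullary using (Dec; does)
open import Relation.Nullary.Decidable using (_×-dec_; _→-dec_)
open import Data.Bool.Properties using (T?)

-- Non-sink vertices 1..n of W_n are represented by Fin n (vertex k+1 ↔ k).
-- A configuration assigns a number of grains to each non-sink vertex.
Config : ℕ → Set
Config n = Vec ℕ n

next : ∀ {n} → Fin n → Fin n
next {suc n} i = fromℕ< (m%n<n (suc (toℕ i)) (suc n))

prev : ∀ {n} → Fin n → Fin n
prev {suc n} i = fromℕ< (m%n<n (toℕ i + n) (suc n))

bit : Bool → ℕ
bit b = if b then 1 else 0

-- every non-sink vertex of W_n (n ≥ 3) has degree 3
Stable : ∀ {n} → Config n → Set
Stable {n} c = (i : Fin n) → suc (lookup c i) ≤ 3

-- result of toppling vertex i where the grains sent to next i, prev i, and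
-- the sink 0 are chosen by the bits a, b, s respectively (grains to the sink are lost)
toppleAt : ∀ {n} → Config n → Fin n → Bool → Bool → Bool → Config n
toppleAt c i a b s = tabulate λ j →
  (if does (j ≟ᶠ i) then lookup c j Data.Nat.∸ (bit a + bit b + bit s) else lookup c j)
  + (if does (j ≟ᶠ next i) then bit a else 0)
  + (if does (j ≟ᶠ prev i) then bit b else 0)

-- one SSM toppling of an unstable vertex, with each possible (positive
-- probability) outcome of the independent coin flips
data Topple {n : ℕ} : Config n → Config n → Set where
  topple : ∀ (c : Config n) (i : Fin n) (a b s : Bool) →
           3 ≤ lookup c i → Topple c (toppleAt c i a b s)

Stabilises : ∀ {n} → Config n → Config n → Set
Stabilises c d = Star Topple c d × Stable d

addGrain : ∀ {n} → Config n → Fin n → Config n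
addGrain c i = tabulate λ j → if does (j ≟ᶠ i) then suc (lookup c j) else lookup c j

-- one step of the Markov chain has positive probability (all μ_i > 0, p ∈ (0,1))
ChainStep : ∀ {n} → Config n → Config n → Set
ChainStep {n} c d = Σ (Fin n) λ i → Stabilises (addGrain c i) d

-- recurrent states of a finite Markov chain: c is a state (stable) and every
-- state reachable from c can reach c back
Recurrent : ∀ {n} → Config n → Set
Recurrent c = Stable c × (∀ d → Star ChainStep c d → Star ChainStep d c)

_≤ᶜ_ : ∀ {n} → Config n → Config n → Set
_≤ᶜ_ {n} c d = (i : Fin n) → lookup c i ≤ lookup d i

MinimalRecurrent : ∀ {n} → Config n → Set
MinimalRecurrent c = Recurrent c × (∀ d → Recurrent d → d ≤ᶜ c → d ≡ c)

-- k ∈ (j,i): k strictly between j and i going clockwise from j (for j ≠ i)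
inOpen : ∀ {n} → Fin n → Fin n → Fin n → Bool
inOpen j i k =
  if toℕ j <ᵇ toℕ i
  then ((toℕ j <ᵇ toℕ k) ∧ (toℕ k <ᵇ toℕ i))
  else ((toℕ j <ᵇ toℕ k) ∨ (toℕ k <ᵇ toℕ i))

CyclicallyFirstMaximal : ∀ {n} → Config n → Fin n → Set
CyclicallyFirstMaximal {n} c i =
  lookup c i ≡ 2 ×
  Σ (Fin n) λ j → lookup c j ≡ 0 × ((k : Fin n) → T (inOpen j i k) → lookup c k ≡ 1)

cfm? : ∀ {n} (c : Config n) (i : Fin n) → Dec (CyclicallyFirstMaximal c i)
cfm? c i = (lookup c i ≟ 2) ×-dec
  any? (λ j → (lookup c j ≟ 0) ×-dec all? (λ k → T? (inOpen j i k) →-dec (lookup c k ≟ 1)))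

m : ∀ {n} → Config n → Config n
m c = tabulate λ i →
  if does (lookup c i ≟ 0) then 0
  else if does (cfm? c i) then 2 else 1

size : ∀ {n} → Config n → ℕ
size c = sum c

-- level(c) = Σ c_i + deg(0) − |E(W_n)|, with deg(0) = n and |E(W_n)| = 2n
level : ∀ {n} → Config n → ℤ
level {n} c = + (sum c + n) -ℤ + (2 * n)

{-# OPTIONS --safe #-}
module Submission where

-- A stable configuration on W_n is recurrent exactly when it dominates the in-degree vector of some
-- orientation of the cycle C_n. Domination holds for the all-2 configuration and survives adding grains
-- and every toppling, once the edges along which grains moved are turned away from the toppling vertex.
-- Conversely the all-2 configuration is reachable from every stable configuration, and every dominating
-- stable configuration other than it has a dominating predecessor of larger size, so it is reached back.
-- In-degree vectors have size n, hence they are minimal recurrent and every recurrent configuration has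
-- size at least n. Finally m(c) is the in-degree vector of the orientation pointing the edge {k, k+1}
-- clockwise iff k+1 follows a zero and a run of ones; this gives |m(c)| = n, hence the level formula,
-- and since m(c) ≤ c, minimality of c forces m(c) = c.

open import Defs
import Algebra.Properties.CommutativeMonoid.Sum as CommutativeMonoidSum
open import Data.Bool using (Bool; true; false; T; not; _∧_; _∨_; if_then_else_)
open import Data.Bool.Properties using (T-∧; T-∨; T?) renaming (_≟_ to _≟ᵇ_)
open import Data.Empty using (⊥-elim)
open import Data.Fin using (Fin; zero; suc; toℕ; fromℕ; inject₁) renaming (_≟_ to _≟ᶠ_)
open import Data.Fin.Induction using (<-weakInduction; <-weakInduction-startingFrom)
open import Data.Fin.Properties using (toℕ-injective; toℕ<n; toℕ-fromℕ<; toℕ-fromℕ; toℕ-inject₁; ≤fromℕ; 0≢1+n; any?; all?)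
import Data.Integer as ℤ
open import Data.Integer using (_⊖_)
open import Data.Integer.Properties using ([+m]-[+n]≡m⊖n; +-cancelˡ-⊖)
open import Data.Nat using (ℕ; zero; suc; _+_; _*_; _∸_; _≤_; _<_; _<ᵇ_; z≤n; s≤s; s≤s⁻¹; _≟_; _<?_)
open import Data.Nat.DivMod using (_%_; m<n⇒m%n≡m; n%n≡0; [m+n]%n≡m%n)
open import Data.Nat.Properties hiding (0≢1+n)
open import Algebra.Properties.CommutativeSemigroup +-commutativeSemigroup using (xy∙z≈zy∙x; x∙yz≈y∙xz)
open import Data.Product as Product using (Σ; ∃; _×_; _,_; proj₁; proj₂)
open import Data.Sum as Sum using (_⊎_; inj₁; inj₂)
open import Data.Vec using (Vec; []; _∷_; lookup; tabulate; replicate; sum; _[_]%=_; _[_]≔_)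
open import Data.Vec.Properties
  using (lookup∘tabulate; lookup∘updateAt; lookup∘updateAt′; []%=-∘; []%=-id; updateAt-cong; updateAt-id-local; []≔-lookup; lookup-replicate)
open import Data.Vec.Relation.Binary.Pointwise.Extensional using (ext; Pointwise-≡⇒≡)
open import Function using (_∘_; id; flip; _⇔_; mk⇔; Equivalence; case_of_)
open import Level using (Level)
open import Relation.Binary using (tri<; tri≈; tri>)
open import Relation.Binary.Construct.Closure.ReflexiveTransitive using (Star; ε; _◅_; _◅◅_; reverse)
open import Relation.Binary.Construct.Closure.ReflexiveTransitive.Properties using (module StarReasoning)
open import Relation.Binary.PropositionalEquality hiding (J)
open import Relation.Nullary using (¬_; Dec; yes; no; does; contradiction)
open import Relation.Nullary.Decidable using (_×-dec_; _⊎-dec_; _→-dec_; ¬?; decidable-stable; dec-true; dec-false; does-⇔)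
open import Relation.Unary using (Pred; Decidable)

private
  variable
    n : ℕ
    ℓ : Level

-- Configurations

lookup-ext : {xs ys : Vec ℕ n} → (∀ i → lookup xs i ≡ lookup ys i) → xs ≡ ys
lookup-ext eq = Pointwise-≡⇒≡ (ext eq)

sum-mono-≤ᶜ : {xs ys : Vec ℕ n} → xs ≤ᶜ ys → sum xs ≤ sum ys
sum-mono-≤ᶜ {xs = []}     {[]}     _  = z≤n
sum-mono-≤ᶜ {xs = x ∷ xs} {y ∷ ys} le = +-mono-≤ (le zero) (sum-mono-≤ᶜ {xs = xs} {ys} (le ∘ suc))

≤ᶜ∧sum≤⇒≡ : {xs ys : Vec ℕ n} → xs ≤ᶜ ys → sum ys ≤ sum xs → xs ≡ ys
≤ᶜ∧sum≤⇒≡ {xs = []}     {[]}     _  _ = refl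
≤ᶜ∧sum≤⇒≡ {xs = x ∷ xs} {y ∷ ys} le ge =
  cong₂ _∷_ x≡y (≤ᶜ∧sum≤⇒≡ {xs = xs} {ys} (le ∘ suc) Σys≤Σxs)
  where
  Σxs≤Σys : sum xs ≤ sum ys
  Σxs≤Σys = sum-mono-≤ᶜ {xs = xs} {ys} (le ∘ suc)
  x≡y : x ≡ y
  x≡y = ≤-antisym (le zero) (+-cancelʳ-≤ (sum xs) y x (≤-trans (+-monoʳ-≤ y Σxs≤Σys) ge))
  Σys≤Σxs : sum ys ≤ sum xs
  Σys≤Σxs = +-cancelˡ-≤ x (sum ys) (sum xs) (subst (λ z → z + sum ys ≤ x + sum xs) (sym x≡y) ge)

sum-updateAt : (xs : Vec ℕ n) (i : Fin n) (f : ℕ → ℕ) →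
               sum (xs [ i ]%= f) + lookup xs i ≡ sum xs + f (lookup xs i)
sum-updateAt (x ∷ xs) zero    f = xy∙z≈zy∙x (f x) (sum xs) x
sum-updateAt (x ∷ xs) (suc i) f = begin
  x + sum (xs [ i ]%= f) + lookup xs i   ≡⟨ +-assoc x _ _ ⟩
  x + (sum (xs [ i ]%= f) + lookup xs i) ≡⟨ cong (x +_) (sum-updateAt xs i f) ⟩
  x + (sum xs + f (lookup xs i))         ≡⟨ +-assoc x _ _ ⟨
  x + sum xs + f (lookup xs i)           ∎
  where open ≡-Reasoning

sum-updateAt-+ : (xs : Vec ℕ n) (i : Fin n) (k : ℕ) → sum (xs [ i ]%= (k +_)) ≡ sum xs + k
sum-updateAt-+ xs i k = +-cancelʳ-≡ (lookup xs i) _ _ (begin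
  sum (xs [ i ]%= (k +_)) + lookup xs i ≡⟨ sum-updateAt xs i (k +_) ⟩
  sum xs + (k + lookup xs i)            ≡⟨ +-assoc (sum xs) k _ ⟨
  sum xs + k + lookup xs i              ∎)
  where open ≡-Reasoning

zero-or-one : ∀ {v} → v < 3 → v ≢ 2 → v ≡ 0 ⊎ v ≡ 1
zero-or-one {0}                 _                      _  = inj₁ refl
zero-or-one {1}                 _                      _  = inj₂ refl
zero-or-one {2}                 _                      ≢2 = contradiction refl ≢2
zero-or-one {suc (suc (suc _))} (s≤s (s≤s (s≤s ()))) _

≤ᶜ-updateAt : (xs : Vec ℕ n) (i : Fin n) {f : ℕ → ℕ} → (∀ x → x ≤ f x) → xs ≤ᶜ (xs [ i ]%= f)
≤ᶜ-updateAt xs i x≤fx j with j ≟ᶠ i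
... | yes refl = subst (lookup xs j ≤_) (sym (lookup∘updateAt j xs)) (x≤fx _)
... | no  j≢i  = ≤-reflexive (sym (lookup∘updateAt′ j i j≢i xs))

addGrain≡ : (c : Config n) (i : Fin n) → addGrain c i ≡ c [ i ]%= suc
addGrain≡ c i = lookup-ext at
  where
  at : ∀ j → lookup (addGrain c i) j ≡ lookup (c [ i ]%= suc) j
  at j rewrite lookup∘tabulate (λ j → if does (j ≟ᶠ i) then suc (lookup c j) else lookup c j) j
    with j ≟ᶠ i
  ... | yes refl = sym (lookup∘updateAt j c)
  ... | no  j≢i  = sym (lookup∘updateAt′ j i j≢i c)

Stable-chain : {c d : Config n} → Star ChainStep c d → Stable c → Stable d
Stable-chain ε                          st = st
Stable-chain ((_ , _ , st′) ◅ steps) _  = Stable-chain steps st′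

Stable-updateAt : (c : Config n) (i : Fin n) (f : ℕ → ℕ) → f (lookup c i) < 3 → Stable c → Stable (c [ i ]%= f)
Stable-updateAt c i f small st j with j ≟ᶠ i
... | yes refl = subst (_< 3) (sym (lookup∘updateAt j c)) small
... | no  j≢i  = subst (_< 3) (sym (lookup∘updateAt′ j i j≢i c)) (st j)

-- The cycle

data LastOrInject₁ : Fin (suc n) → Set where
  last   : LastOrInject₁ (fromℕ n)
  inject : (j : Fin n) → LastOrInject₁ (inject₁ j)

lastOrInject₁ : (i : Fin (suc n)) → LastOrInject₁ i
lastOrInject₁ {zero}  zero    = last
lastOrInject₁ {suc n} zero    = inject zero
lastOrInject₁ {suc n} (suc i) with lastOrInject₁ i
... | last     = last
... | inject j = inject (suc j)

next-inject₁ : (j : Fin n) → next (inject₁ j) ≡ suc j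
next-inject₁ {n} j = toℕ-injective (begin
  toℕ (next (inject₁ j))        ≡⟨ toℕ-fromℕ< _ ⟩
  suc (toℕ (inject₁ j)) % suc n ≡⟨ cong (λ x → suc x % suc n) (toℕ-inject₁ j) ⟩
  suc (toℕ j) % suc n           ≡⟨ m<n⇒m%n≡m (s≤s (toℕ<n j)) ⟩
  suc (toℕ j)                   ∎)
  where open ≡-Reasoning

next-last : next (fromℕ n) ≡ zero
next-last {n} = toℕ-injective (begin
  toℕ (next (fromℕ n))        ≡⟨ toℕ-fromℕ< _ ⟩
  suc (toℕ (fromℕ n)) % suc n ≡⟨ cong (λ x → suc x % suc n) (toℕ-fromℕ n) ⟩
  suc n % suc n               ≡⟨ n%n≡0 (suc n) ⟩
  0                           ∎)
  where open ≡-Reasoning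

prev-zero : prev {suc n} zero ≡ fromℕ n
prev-zero {n} = toℕ-injective (begin
  toℕ (prev {suc n} zero) ≡⟨ toℕ-fromℕ< _ ⟩
  n % suc n               ≡⟨ m<n⇒m%n≡m ≤-refl ⟩
  n                       ≡⟨ toℕ-fromℕ n ⟨
  toℕ (fromℕ n)           ∎)
  where open ≡-Reasoning

prev-suc : (j : Fin n) → prev (suc j) ≡ inject₁ j
prev-suc {n} j = toℕ-injective (begin
  toℕ (prev (suc j))        ≡⟨ toℕ-fromℕ< _ ⟩
  (suc (toℕ j) + n) % suc n ≡⟨ cong (_% suc n) (+-suc (toℕ j) n) ⟨
  (toℕ j + suc n) % suc n   ≡⟨ [m+n]%n≡m%n (toℕ j) (suc n) ⟩
  toℕ j % suc n             ≡⟨ m<n⇒m%n≡m (m<n⇒m<1+n (toℕ<n j)) ⟩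
  toℕ j                     ≡⟨ toℕ-inject₁ j ⟨
  toℕ (inject₁ j)           ∎)
  where open ≡-Reasoning

next-prev : (i : Fin (suc n)) → next (prev i) ≡ i
next-prev zero    = trans (cong next prev-zero) next-last
next-prev (suc j) = trans (cong next (prev-suc j)) (next-inject₁ j)

prev-next : (i : Fin (suc n)) → prev (next i) ≡ i
prev-next i with lastOrInject₁ i
... | last     = trans (cong prev next-last) prev-zero
... | inject j = trans (cong prev (next-inject₁ j)) (prev-suc j)

toℕ-next : (i : Fin (suc n)) → toℕ (next i) ≡ suc (toℕ i) ⊎ (toℕ (next i) ≡ 0 × toℕ i ≡ n)
toℕ-next i with lastOrInject₁ i
... | last     = inj₂ (cong toℕ next-last , toℕ-fromℕ _)
... | inject j = inj₁ (trans (cong toℕ (next-inject₁ j)) (cong suc (sym (toℕ-inject₁ j))))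

suc≢inject₁ : (j : Fin n) → suc j ≢ inject₁ j
suc≢inject₁ j eq = 1+n≢n (trans (cong toℕ eq) (toℕ-inject₁ j))

next≢ : (i : Fin (suc (suc n))) → next i ≢ i
next≢ i with lastOrInject₁ i
... | last     = λ eq → 0≢1+n (trans (sym next-last) eq)
... | inject j = λ eq → suc≢inject₁ j (trans (sym (next-inject₁ j)) eq)

next²≢ : (i : Fin (suc (suc (suc n)))) → next (next i) ≢ i
next²≢ i with lastOrInject₁ i
... | last = λ eq → case trans (sym (trans (cong next next-last) (next-inject₁ zero))) eq of λ ()
... | inject j with lastOrInject₁ j
...   | last      = λ eq → 0≢1+n (trans (sym (trans (cong next (next-inject₁ j)) next-last)) eq)
...   | inject j′ = λ eq → <⇒≢ (m<n⇒m<1+n (n<1+n (toℕ j′))) (sym (begin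
  suc (suc (toℕ j′))          ≡⟨ cong toℕ (trans (cong next (next-inject₁ j)) (next-inject₁ (suc j′))) ⟨
  toℕ (next (next i))         ≡⟨ cong toℕ eq ⟩
  toℕ (inject₁ (inject₁ j′))  ≡⟨ trans (toℕ-inject₁ (inject₁ j′)) (toℕ-inject₁ j′) ⟩
  toℕ j′                      ∎))
  where open ≡-Reasoning

prev≡⇒≡next : {i k : Fin (suc n)} → prev k ≡ i → k ≡ next i
prev≡⇒≡next {k = k} eq = trans (sym (next-prev k)) (cong next eq)

prev-injective : {i k : Fin (suc n)} → prev k ≡ prev i → k ≡ i
prev-injective {i = i} eq = trans (prev≡⇒≡next eq) (next-prev i)

prev≢ : (i : Fin (suc (suc n))) → prev i ≢ i
prev≢ i eq = next≢ i (trans (cong next (sym eq)) (next-prev i))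

next≢prev : (i : Fin (suc (suc (suc n)))) → next i ≢ prev i
next≢prev i eq = next²≢ i (trans (cong next eq) (next-prev i))

prev²≢ : (i : Fin (suc (suc (suc n)))) → prev (prev i) ≢ i
prev²≢ i eq = next²≢ (prev (prev i)) (begin
  next (next (prev (prev i))) ≡⟨ cong next (next-prev (prev i)) ⟩
  next (prev i)               ≡⟨ next-prev i ⟩
  i                           ≡⟨ eq ⟨
  prev (prev i)               ∎)
  where open ≡-Reasoning

cycle-induction : (P : Pred (Fin (suc n)) ℓ) {x : Fin (suc n)} → P x →
                  (∀ k → P k → P (next k)) → ∀ y → P y
cycle-induction P {x} Px step = <-weakInduction P P₀ step′
  where
  step′ : ∀ j → P (inject₁ j) → P (suc j)
  step′ j = subst P (next-inject₁ j) ∘ step (inject₁ j)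
  P₀ : P zero
  P₀ = subst P next-last (step _ (<-weakInduction-startingFrom P Px step′ (≤fromℕ x)))

boundary : {Q : Pred (Fin (suc n)) ℓ} → Decidable Q → ∀ {x y} → Q x → ¬ Q y →
           ∃ λ w → Q w × ¬ Q (next w)
boundary {Q = Q} Q? {x} {y} Qx ¬Qy with any? (λ w → Q? w ×-dec ¬? (Q? (next w)))
... | yes found = found
... | no  none  = contradiction (cycle-induction Q Qx closed y) ¬Qy
  where
  closed : ∀ k → Q k → Q (next k)
  closed k Qk = decidable-stable (Q? (next k)) (λ ¬Qnk → none (k , Qk , ¬Qnk))

module ∑ℕ = CommutativeMonoidSum +-0-commutativeMonoid
open ∑ℕ using (sum-syntax)

sum-tabulate : (f : Fin n → ℕ) → sum (tabulate f) ≡ ∑[ i < n ] f i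
sum-tabulate {zero}  f = refl
sum-tabulate {suc n} f = cong (f zero +_) (sum-tabulate (f ∘ suc))

∑-prev : (f : Fin (suc n) → ℕ) → ∑[ i < suc n ] f (prev i) ≡ ∑[ i < suc n ] f i
∑-prev {n} f = begin
  f (prev zero) + ∑[ i < n ] f (prev (suc i)) ≡⟨ cong₂ _+_ (cong f prev-zero) (∑ℕ.sum-cong-≗ (cong f ∘ prev-suc)) ⟩
  f (fromℕ n) + ∑[ i < n ] f (inject₁ i)      ≡⟨ +-comm (f (fromℕ n)) _ ⟩
  ∑[ i < n ] f (inject₁ i) + f (fromℕ n)      ≡⟨ ∑ℕ.sum-init-last f ⟨
  ∑[ i < suc n ] f i                          ∎
  where open ≡-Reasoning

Between : ℕ → ℕ → ℕ → Set
Between J I L = (J < I × J < L × L < I) ⊎ (I ≤ J × (J < L ⊎ L < I))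

T-inOpen⇒Between : (j i l : Fin n) → T (inOpen j i l) → Between (toℕ j) (toℕ i) (toℕ l)
T-inOpen⇒Between j i l t with toℕ j <ᵇ toℕ i in eq
... | true  = let (j<l , l<i) = Equivalence.to T-∧ t in
              inj₁ (<ᵇ⇒< _ _ (subst T (sym eq) _) , <ᵇ⇒< _ _ j<l , <ᵇ⇒< _ _ l<i)
... | false = inj₂ (≮⇒≥ (λ j<i → subst T eq (<⇒<ᵇ j<i)) , Sum.map (<ᵇ⇒< _ _) (<ᵇ⇒< _ _) (Equivalence.to T-∨ t))

Between⇒T-inOpen : (j i l : Fin n) → Between (toℕ j) (toℕ i) (toℕ l) → T (inOpen j i l)
Between⇒T-inOpen j i l b with toℕ j <ᵇ toℕ i in eq | b
... | true  | inj₁ (_ , j<l , l<i)    = Equivalence.from T-∧ (<⇒<ᵇ j<l , <⇒<ᵇ l<i)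
... | true  | inj₂ (i≤j , _)         = ⊥-elim (<⇒≱ (<ᵇ⇒< _ _ (subst T (sym eq) _)) i≤j)
... | false | inj₁ (j<i , _)         = ⊥-elim (subst T eq (<⇒<ᵇ j<i))
... | false | inj₂ (_ , j<l⊎l<i)     = Equivalence.from T-∨ (Sum.map <⇒<ᵇ <⇒<ᵇ j<l⊎l<i)

private
  variable
    J K L : ℕ

Between-suc⁻ : Between J (suc K) L → K ≢ J × (Between J K L ⊎ L ≡ K)
Between-suc⁻ (inj₁ (_ , j<l , s≤s l≤k)) with m≤n⇒m<n∨m≡n l≤k
... | inj₁ l<k  = >⇒≢ (<-trans j<l l<k) , inj₁ (inj₁ (<-trans j<l l<k , j<l , l<k))
... | inj₂ refl = >⇒≢ j<l , inj₂ refl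
Between-suc⁻ (inj₂ (k<j , inj₁ j<l))       = <⇒≢ k<j , inj₁ (inj₂ (<⇒≤ k<j , inj₁ j<l))
Between-suc⁻ (inj₂ (k<j , inj₂ (s≤s l≤k))) with m≤n⇒m<n∨m≡n l≤k
... | inj₁ l<k  = <⇒≢ k<j , inj₁ (inj₂ (<⇒≤ k<j , inj₂ l<k))
... | inj₂ refl = <⇒≢ k<j , inj₂ refl

Between-suc⁺ : K ≢ J → Between J K L ⊎ L ≡ K → Between J (suc K) L
Between-suc⁺ _   (inj₁ (inj₁ (j<k , j<l , l<k))) = inj₁ (m<n⇒m<1+n j<k , j<l , m<n⇒m<1+n l<k)
Between-suc⁺ k≢j (inj₁ (inj₂ (k≤j , j<l⊎l<k)))  = inj₂ (≤∧≢⇒< k≤j k≢j , Sum.map₂ m<n⇒m<1+n j<l⊎l<k)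
Between-suc⁺ {K} {J} k≢j (inj₂ refl) with <-cmp J K
... | tri< j<k _ _ = inj₁ (m<n⇒m<1+n j<k , j<k , n<1+n K)
... | tri≈ _ j≡k _ = contradiction (sym j≡k) k≢j
... | tri> _ _ k<j = inj₂ (k<j , inj₂ (n<1+n K))

Between-zero⁻ : L ≤ K → Between J 0 L → K ≢ J × (Between J K L ⊎ L ≡ K)
Between-zero⁻ l≤k (inj₂ (_ , inj₁ j<l)) with m≤n⇒m<n∨m≡n l≤k
... | inj₁ l<k  = >⇒≢ (<-trans j<l l<k) , inj₁ (inj₁ (<-trans j<l l<k , j<l , l<k))
... | inj₂ refl = >⇒≢ j<l , inj₂ refl

Between-zero⁺ : J ≤ K → K ≢ J → Between J K L ⊎ L ≡ K → Between J 0 L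
Between-zero⁺ {J = J} {K = K} {L = L} j≤k k≢j b = inj₂ (z≤n , inj₁ (J<L b))
  where
  J<L : Between J K L ⊎ L ≡ K → J < L
  J<L (inj₁ (inj₁ (_ , j<l , _))) = j<l
  J<L (inj₁ (inj₂ (k≤j , _)))     = contradiction (≤-antisym k≤j j≤k) k≢j
  J<L (inj₂ refl)                 = ≤∧≢⇒< j≤k (k≢j ∘ sym)

module _ (j k l : Fin (suc n)) where

  private
    fromℕ-level : toℕ k ≢ toℕ j × (Between (toℕ j) (toℕ k) (toℕ l) ⊎ toℕ l ≡ toℕ k) →
                  k ≢ j × (T (inOpen j k l) ⊎ l ≡ k)
    fromℕ-level (k≢j , b) = k≢j ∘ cong toℕ , Sum.map (Between⇒T-inOpen j k l) toℕ-injective b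

  inOpen-next⁻ : T (inOpen j (next k) l) → k ≢ j × (T (inOpen j k l) ⊎ l ≡ k)
  inOpen-next⁻ t with T-inOpen⇒Between j (next k) l t | toℕ-next k
  ... | b | inj₁ eq        = fromℕ-level (Between-suc⁻ (subst (λ I → Between _ I _) eq b))
  ... | b | inj₂ (eq , k≡n) = fromℕ-level (Between-zero⁻ (subst (toℕ l ≤_) (sym k≡n) (s≤s⁻¹ (toℕ<n l)))
                                                       (subst (λ I → Between _ I _) eq b))

  inOpen-next⁺ : k ≢ j → T (inOpen j k l) ⊎ l ≡ k → T (inOpen j (next k) l)
  inOpen-next⁺ k≢j t = Between⇒T-inOpen j (next k) l (extend (toℕ-next k))
    where
    k≢j′ : toℕ k ≢ toℕ j
    k≢j′ = k≢j ∘ toℕ-injective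
    b : Between (toℕ j) (toℕ k) (toℕ l) ⊎ toℕ l ≡ toℕ k
    b = Sum.map (T-inOpen⇒Between j k l) (cong toℕ) t
    extend : toℕ (next k) ≡ suc (toℕ k) ⊎ (toℕ (next k) ≡ 0 × toℕ k ≡ n) → Between (toℕ j) (toℕ (next k)) (toℕ l)
    extend (inj₁ eq)        = subst (λ I → Between _ I _) (sym eq) (Between-suc⁺ k≢j′ b)
    extend (inj₂ (eq , k≡n)) = subst (λ I → Between _ I _) (sym eq)
                                 (Between-zero⁺ (subst (toℕ j ≤_) (sym k≡n) (s≤s⁻¹ (toℕ<n j))) k≢j′ b)

-- Orientations of the cycle

bit≤1 : ∀ b → bit b ≤ 1
bit≤1 true  = ≤-refl
bit≤1 false = z≤n

bit+bit-not : ∀ b → bit b + bit (not b) ≡ 1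
bit+bit-not true  = refl
bit+bit-not false = refl

bit-∨ : ∀ a x → bit (a ∨ x) ≤ bit a + bit x
bit-∨ true  x = m≤m+n 1 (bit x)
bit-∨ false x = ≤-refl

bit-not-∧ : ∀ b x → bit (not (not b ∧ x)) ≤ bit b + bit (not x)
bit-not-∧ true  x = m≤m+n 1 (bit (not x))
bit-not-∧ false x = ≤-refl

topple-budget : ∀ a b s x y → bit (not b ∧ x) + bit (not (a ∨ y)) + (bit a + bit b + bit s) ≤ 3
topple-budget true  true  s x y = s≤s (s≤s (bit≤1 s))
topple-budget true  false s x y = +-mono-≤ (+-mono-≤ {v = 0} (bit≤1 x) z≤n) (s≤s (bit≤1 s))
topple-budget false true  s x y = +-mono-≤ (bit≤1 (not y)) (s≤s (bit≤1 s))
topple-budget false false s x y = +-mono-≤ (+-mono-≤ (bit≤1 x) (bit≤1 (not y))) (bit≤1 s)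

-- o k = true orients the cycle edge {k, next k} towards next k.
Orientation : ℕ → Set
Orientation n = Fin n → Bool

inDegree : Orientation (suc n) → Fin (suc n) → ℕ
inDegree o k = bit (o (prev k)) + bit (not (o k))

inDegrees : Orientation (suc n) → Config (suc n)
inDegrees o = tabulate (inDegree o)

record Oriented (c : Config (suc n)) : Set where
  constructor oriented
  field
    orientation : Orientation (suc n)
    inDegree≤   : ∀ k → inDegree orientation k ≤ lookup c k

inDegree≤2 : (o : Orientation (suc n)) (k : Fin (suc n)) → inDegree o k ≤ 2
inDegree≤2 o k = +-mono-≤ (bit≤1 (o (prev k))) (bit≤1 (not (o k)))

sum-inDegrees : (o : Orientation (suc n)) → sum (inDegrees o) ≡ suc n
sum-inDegrees {n} o = begin
  sum (inDegrees o)                                           ≡⟨ sum-tabulate (inDegree o) ⟩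
  ∑[ k < suc n ] (bit (o (prev k)) + bit (not (o k)))         ≡⟨ ∑ℕ.∑-distrib-+ (bit ∘ o ∘ prev) (bit ∘ not ∘ o) ⟩
  ∑[ k < suc n ] bit (o (prev k)) + ∑[ k < suc n ] bit (not (o k))
    ≡⟨ cong (_+ ∑[ k < suc n ] bit (not (o k))) (∑-prev (bit ∘ o)) ⟩
  ∑[ k < suc n ] bit (o k) + ∑[ k < suc n ] bit (not (o k))   ≡⟨ ∑ℕ.∑-distrib-+ (bit ∘ o) (bit ∘ not ∘ o) ⟨
  ∑[ k < suc n ] (bit (o k) + bit (not (o k)))                ≡⟨ ∑ℕ.sum-cong-≗ (bit+bit-not ∘ o) ⟩
  ∑[ k < suc n ] 1                                            ≡⟨ ∑1≡n (suc n) ⟩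
  suc n                                                       ∎
  where
  open ≡-Reasoning
  ∑1≡n : ∀ m → ∑[ k < m ] 1 ≡ m
  ∑1≡n zero    = refl
  ∑1≡n (suc m) = cong suc (∑1≡n m)

inDegree≡0 : (o : Orientation (suc n)) (k : Fin (suc n)) → inDegree o k ≤ 0 → o (prev k) ≡ false × o k ≡ true
inDegree≡0 o k = bits (o (prev k)) (o k)
  where
  bits : ∀ x y → bit x + bit (not y) ≤ 0 → x ≡ false × y ≡ true
  bits false true  _ = refl , refl
  bits false false ()
  bits true  _     ()

inDegree≥1 : (o : Orientation (suc n)) (k : Fin (suc n)) → o (prev k) ≡ true → 1 ≤ inDegree o k
inDegree≥1 o k incoming rewrite incoming = s≤s z≤n

inDegree≤1 : (o : Orientation (suc n)) (k : Fin (suc n)) → o (prev k) ≡ true → inDegree o k ≤ 1 → o k ≡ true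
inDegree≤1 o k incoming rewrite incoming = bits (o k)
  where
  bits : ∀ y → 1 + bit (not y) ≤ 1 → y ≡ true
  bits true  _ = refl
  bits false (s≤s ())

Oriented-mono : {c d : Config (suc n)} → c ≤ᶜ d → Oriented c → Oriented d
Oriented-mono c≤d (oriented o o≤c) = oriented o λ k → ≤-trans (o≤c k) (c≤d k)

Oriented⇒size≥ : {c : Config (suc n)} → Oriented c → suc n ≤ sum c
Oriented⇒size≥ {c = c} (oriented o o≤c) =
  subst (_≤ sum c) (sum-inDegrees o) (sum-mono-≤ᶜ {xs = inDegrees o} {c} inDegrees≤c)
  where
  inDegrees≤c : inDegrees o ≤ᶜ c
  inDegrees≤c k = subst (_≤ lookup c k) (sym (lookup∘tabulate (inDegree o) k)) (o≤c k)

module Wheel (n : ℕ) where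

  N : ℕ
  N = suc (suc (suc n))

  Vertex : Set
  Vertex = Fin N

  -- Toppling

  private
    lookup-toppleAt : ∀ c i a b s (j : Vertex) → lookup (toppleAt c i a b s) j ≡
      (if does (j ≟ᶠ i) then lookup c j ∸ (bit a + bit b + bit s) else lookup c j)
      + (if does (j ≟ᶠ next i) then bit a else 0) + (if does (j ≟ᶠ prev i) then bit b else 0)
    lookup-toppleAt c i a b s j = lookup∘tabulate (λ j →
      (if does (j ≟ᶠ i) then lookup c j ∸ (bit a + bit b + bit s) else lookup c j)
      + (if does (j ≟ᶠ next i) then bit a else 0) + (if does (j ≟ᶠ prev i) then bit b else 0)) j

  toppleAt-self : ∀ c i a b s → lookup (toppleAt c i a b s) i ≡ lookup c i ∸ (bit a + bit b + bit s)
  toppleAt-self c i a b s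
    rewrite lookup-toppleAt c i a b s i | dec-true (i ≟ᶠ i) refl
          | dec-false (i ≟ᶠ next i) (next≢ i ∘ sym) | dec-false (i ≟ᶠ prev i) (prev≢ i ∘ sym)
    = trans (+-identityʳ _) (+-identityʳ _)

  toppleAt-next : ∀ c i a b s → lookup (toppleAt c i a b s) (next i) ≡ bit a + lookup c (next i)
  toppleAt-next c i a b s
    rewrite lookup-toppleAt c i a b s (next i) | dec-false (next i ≟ᶠ i) (next≢ i)
          | dec-true (next i ≟ᶠ next i) refl | dec-false (next i ≟ᶠ prev i) (next≢prev i)
    = trans (+-identityʳ _) (+-comm (lookup c (next i)) (bit a))

  toppleAt-prev : ∀ c i a b s → lookup (toppleAt c i a b s) (prev i) ≡ bit b + lookup c (prev i)
  toppleAt-prev c i a b s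
    rewrite lookup-toppleAt c i a b s (prev i) | dec-false (prev i ≟ᶠ i) (prev≢ i)
          | dec-false (prev i ≟ᶠ next i) (next≢prev i ∘ sym) | dec-true (prev i ≟ᶠ prev i) refl
    = trans (cong (_+ bit b) (+-identityʳ _)) (+-comm (lookup c (prev i)) (bit b))

  toppleAt-other : ∀ c i a b s {j} → j ≢ i → j ≢ next i → j ≢ prev i → lookup (toppleAt c i a b s) j ≡ lookup c j
  toppleAt-other c i a b s {j} j≢i j≢ni j≢pi
    rewrite lookup-toppleAt c i a b s j | dec-false (j ≟ᶠ i) j≢i
          | dec-false (j ≟ᶠ next i) j≢ni | dec-false (j ≟ᶠ prev i) j≢pi
    = trans (+-identityʳ _) (+-identityʳ _)

  toppleAt≡ : ∀ c i a b s → toppleAt c i a b s ≡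
              c [ i ]%= (_∸ (bit a + bit b + bit s)) [ next i ]%= (bit a +_) [ prev i ]%= (bit b +_)
  toppleAt≡ c i a b s = lookup-ext at
    where
    k = bit a + bit b + bit s
    c₁ = c [ i ]%= (_∸ k)
    c₂ = c₁ [ next i ]%= (bit a +_)
    open ≡-Reasoning
    at : ∀ j → lookup (toppleAt c i a b s) j ≡ lookup (c₂ [ prev i ]%= (bit b +_)) j
    at j with j ≟ᶠ i | j ≟ᶠ next i | j ≟ᶠ prev i
    ... | yes refl | _ | _ = begin
      lookup (toppleAt c j a b s) j                 ≡⟨ toppleAt-self c j a b s ⟩
      lookup c j ∸ k                                ≡⟨ lookup∘updateAt j c ⟨
      lookup c₁ j                                   ≡⟨ lookup∘updateAt′ j (next j) (next≢ j ∘ sym) c₁ ⟨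
      lookup c₂ j                                   ≡⟨ lookup∘updateAt′ j (prev j) (prev≢ j ∘ sym) c₂ ⟨
      lookup (c₂ [ prev j ]%= (bit b +_)) j         ∎
    ... | no j≢i | yes refl | _ = begin
      lookup (toppleAt c i a b s) (next i)          ≡⟨ toppleAt-next c i a b s ⟩
      bit a + lookup c (next i)                     ≡⟨ cong (bit a +_) (lookup∘updateAt′ (next i) i j≢i c) ⟨
      bit a + lookup c₁ (next i)                    ≡⟨ lookup∘updateAt (next i) c₁ ⟨
      lookup c₂ (next i)                            ≡⟨ lookup∘updateAt′ (next i) (prev i) (next≢prev i) c₂ ⟨
      lookup (c₂ [ prev i ]%= (bit b +_)) (next i)  ∎
    ... | no j≢i | no j≢ni | yes refl = begin
      lookup (toppleAt c i a b s) (prev i)          ≡⟨ toppleAt-prev c i a b s ⟩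
      bit b + lookup c (prev i)                     ≡⟨ cong (bit b +_) (lookup∘updateAt′ (prev i) i j≢i c) ⟨
      bit b + lookup c₁ (prev i)                    ≡⟨ cong (bit b +_) (lookup∘updateAt′ (prev i) (next i) j≢ni c₁) ⟨
      bit b + lookup c₂ (prev i)                    ≡⟨ lookup∘updateAt (prev i) c₂ ⟨
      lookup (c₂ [ prev i ]%= (bit b +_)) (prev i)  ∎
    ... | no j≢i | no j≢ni | no j≢pi = begin
      lookup (toppleAt c i a b s) j                 ≡⟨ toppleAt-other c i a b s j≢i j≢ni j≢pi ⟩
      lookup c j                                    ≡⟨ lookup∘updateAt′ j i j≢i c ⟨
      lookup c₁ j                                   ≡⟨ lookup∘updateAt′ j (next i) j≢ni c₁ ⟨
      lookup c₂ j                                   ≡⟨ lookup∘updateAt′ j (prev i) j≢pi c₂ ⟨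
      lookup (c₂ [ prev i ]%= (bit b +_)) j         ∎

  -- Sending a grain from i to next i (when a) or to prev i (when b) turns that edge away from i.
  reorient : Orientation N → Vertex → Bool → Bool → Orientation N
  reorient o i a b k = if does (k ≟ᶠ i) then a ∨ o i else if does (k ≟ᶠ prev i) then not b ∧ o k else o k

  module _ (o : Orientation N) (i : Vertex) (a b : Bool) where

    reorient-self : reorient o i a b i ≡ a ∨ o i
    reorient-self rewrite dec-true (i ≟ᶠ i) refl = refl

    reorient-prev : reorient o i a b (prev i) ≡ not b ∧ o (prev i)
    reorient-prev rewrite dec-false (prev i ≟ᶠ i) (prev≢ i) | dec-true (prev i ≟ᶠ prev i) refl = refl

    reorient-other : ∀ {k} → k ≢ i → k ≢ prev i → reorient o i a b k ≡ o k
    reorient-other {k} k≢i k≢pi rewrite dec-false (k ≟ᶠ i) k≢i | dec-false (k ≟ᶠ prev i) k≢pi = refl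

  Oriented-topple : ∀ {c i} a b s → 3 ≤ lookup c i → Oriented c → Oriented (toppleAt c i a b s)
  Oriented-topple {c} {i} a b s unstable (oriented o o≤c) = oriented o′ bound
    where
    o′ = reorient o i a b
    open ≤-Reasoning
    bound : ∀ k → inDegree o′ k ≤ lookup (toppleAt c i a b s) k
    bound k = bound′ k (k ≟ᶠ i) (k ≟ᶠ next i) (k ≟ᶠ prev i)
      where
      bound′ : ∀ k → Dec (k ≡ i) → Dec (k ≡ next i) → Dec (k ≡ prev i) → inDegree o′ k ≤ lookup (toppleAt c i a b s) k
      bound′ k (yes refl) _ _ = begin
        inDegree o′ k                                   ≡⟨ cong₂ (λ x y → bit x + bit (not y))
                                                               (reorient-prev o k a b) (reorient-self o k a b) ⟩
        bit (not b ∧ o (prev k)) + bit (not (a ∨ o k))  ≤⟨ m+n≤o⇒m≤o∸n _ (≤-trans (topple-budget a b s _ _) unstable) ⟩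
        lookup c k ∸ (bit a + bit b + bit s)            ≡⟨ toppleAt-self c k a b s ⟨
        lookup (toppleAt c k a b s) k                   ∎
      bound′ k (no k≢i) (yes refl) _ = begin
        inDegree o′ (next i)                            ≡⟨ cong₂ (λ x y → bit x + bit (not y))
                                                               (trans (cong o′ (prev-next i)) (reorient-self o i a b))
                                                               (reorient-other o i a b k≢i (next≢prev i)) ⟩
        bit (a ∨ o i) + bit (not (o (next i)))          ≤⟨ +-monoˡ-≤ _ (bit-∨ a (o i)) ⟩
        bit a + bit (o i) + bit (not (o (next i)))      ≡⟨ +-assoc (bit a) _ _ ⟩
        bit a + (bit (o i) + bit (not (o (next i))))    ≡⟨ cong (λ x → bit a + (bit (o x) + bit (not (o (next i))))) (prev-next i) ⟨
        bit a + inDegree o (next i)                     ≤⟨ +-monoʳ-≤ (bit a) (o≤c (next i)) ⟩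
        bit a + lookup c (next i)                       ≡⟨ toppleAt-next c i a b s ⟨
        lookup (toppleAt c i a b s) (next i)            ∎
      bound′ k (no k≢i) (no k≢ni) (yes refl) = begin
        inDegree o′ (prev i)                                        ≡⟨ cong₂ (λ x y → bit x + bit (not y))
                                                                         (reorient-other o i a b (prev²≢ i) (prev≢ (prev i)))
                                                                         (reorient-prev o i a b) ⟩
        bit (o (prev (prev i))) + bit (not (not b ∧ o (prev i)))    ≤⟨ +-monoʳ-≤ _ (bit-not-∧ b (o (prev i))) ⟩
        bit (o (prev (prev i))) + (bit b + bit (not (o (prev i))))  ≡⟨ x∙yz≈y∙xz (bit (o (prev (prev i)))) (bit b) _ ⟩
        bit b + inDegree o (prev i)                                 ≤⟨ +-monoʳ-≤ (bit b) (o≤c (prev i)) ⟩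
        bit b + lookup c (prev i)                                   ≡⟨ toppleAt-prev c i a b s ⟨
        lookup (toppleAt c i a b s) (prev i)                        ∎
      bound′ k (no k≢i) (no k≢ni) (no k≢pi) = begin
        inDegree o′ k                         ≡⟨ cong₂ (λ x y → bit x + bit (not y))
                                                   (reorient-other o i a b (k≢ni ∘ prev≡⇒≡next) (k≢i ∘ prev-injective))
                                                   (reorient-other o i a b k≢i k≢pi) ⟩
        inDegree o k                          ≤⟨ o≤c k ⟩
        lookup c k                            ≡⟨ toppleAt-other c i a b s k≢i k≢ni k≢pi ⟨
        lookup (toppleAt c i a b s) k         ∎

  Oriented-topples : {c d : Config N} → Star Topple c d → Oriented c → Oriented d
  Oriented-topples ε                                = id
  Oriented-topples (topple _ _ a b s unstable ◅ ts) = Oriented-topples ts ∘ Oriented-topple a b s unstable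

  Oriented-chain : {c d : Config N} → Star ChainStep c d → Oriented c → Oriented d
  Oriented-chain ε                          = id
  Oriented-chain {c} ((i , ts , _) ◅ steps) =
    Oriented-chain steps ∘ Oriented-topples ts
      ∘ Oriented-mono {c = c} (subst (c ≤ᶜ_) (sym (addGrain≡ c i)) (≤ᶜ-updateAt c i n≤1+n))

  fire : (d : Config N) (i : Vertex) (a b s : Bool) → let k = bit a + bit b + bit s in
         3 ≤ k + lookup d i → Topple (d [ i ]%= (k +_)) (d [ next i ]%= (bit a +_) [ prev i ]%= (bit b +_))
  fire d i a b s unstable =
    subst (Topple d⁺) toppled (topple d⁺ i a b s (subst (3 ≤_) (sym (lookup∘updateAt i d)) unstable))
    where
    k = bit a + bit b + bit s
    d⁺ = d [ i ]%= (k +_)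
    restored : d⁺ [ i ]%= (_∸ k) ≡ d
    restored = begin
      d⁺ [ i ]%= (_∸ k)           ≡⟨ []%=-∘ d i ⟩
      d [ i ]%= (λ x → k + x ∸ k) ≡⟨ updateAt-cong i (m+n∸m≡n k) d ⟩
      d [ i ]%= (λ x → x)         ≡⟨ []%=-id d i ⟩
      d                           ∎
      where open ≡-Reasoning
    toppled : toppleAt d⁺ i a b s ≡ d [ next i ]%= (bit a +_) [ prev i ]%= (bit b +_)
    toppled = trans (toppleAt≡ d⁺ i a b s) (cong (λ x → x [ next i ]%= (bit a +_) [ prev i ]%= (bit b +_)) restored)

  private
    untouched : (xs : Config N) (j : Vertex) → xs [ j ]%= (0 +_) ≡ xs
    untouched xs j = updateAt-id-local j xs refl

  fire-sink : (d : Config N) (i : Vertex) → 2 ≤ lookup d i → Topple (d [ i ]%= suc) d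
  fire-sink d i h = subst (Topple _) (trans (untouched _ (prev i)) (untouched d (next i))) (fire d i false false true (s≤s h))

  fire-next : (d : Config N) (i : Vertex) → 1 ≤ lookup d i → Topple (d [ i ]%= (2 +_)) (d [ next i ]%= suc)
  fire-next d i h = subst (Topple _) (untouched _ (prev i)) (fire d i true false true (s≤s (s≤s h)))

  fire-prev : (d : Config N) (i : Vertex) → 1 ≤ lookup d i → Topple (d [ i ]%= (2 +_)) (d [ prev i ]%= suc)
  fire-prev d i h = subst (Topple _) (cong (_[ prev i ]%= suc) (untouched d (next i))) (fire d i false true true (s≤s (s≤s h)))

  fire-both : (d : Config N) (i : Vertex) → Topple (d [ i ]%= (3 +_)) (d [ next i ]%= suc [ prev i ]%= suc)
  fire-both d i = fire d i true true true (m≤m+n 3 _)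

  addGrain-then-topple : ∀ {c t} (i : Vertex) → Stable t → Star Topple (c [ i ]%= suc) t → ChainStep c t
  addGrain-then-topple {c} {t} i st topples = i , subst (λ x → Star Topple x t) (sym (addGrain≡ c i)) topples , st

  returns-via-next : ∀ {t} i → Stable t → 1 ≤ lookup t i → 2 ≤ lookup t (next i) → ChainStep (t [ i ]%= suc) t
  returns-via-next {t} i st h₁ h₂ = addGrain-then-topple i st (begin
    t [ i ]%= suc [ i ]%= suc ≡⟨ []%=-∘ t i ⟩
    t [ i ]%= (2 +_)          ⟶⟨ fire-next t i h₁ ⟩
    t [ next i ]%= suc        ⟶⟨ fire-sink t (next i) h₂ ⟩
    t                         ∎)
    where open StarReasoning Topple

  returns-via-prev : ∀ {t} i → Stable t → 1 ≤ lookup t i → 2 ≤ lookup t (prev i) → ChainStep (t [ i ]%= suc) t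
  returns-via-prev {t} i st h₁ h₂ = addGrain-then-topple i st (begin
    t [ i ]%= suc [ i ]%= suc ≡⟨ []%=-∘ t i ⟩
    t [ i ]%= (2 +_)          ⟶⟨ fire-prev t i h₁ ⟩
    t [ prev i ]%= suc        ⟶⟨ fire-sink t (prev i) h₂ ⟩
    t                         ∎)
    where open StarReasoning Topple

  returns-via-both : ∀ {t} i → Stable t → 2 ≤ lookup t (next i) → 2 ≤ lookup t (prev i) →
                     ChainStep (t [ i ]%= (2 +_)) t
  returns-via-both {t} i st h₁ h₂ = addGrain-then-topple i st (begin
    t [ i ]%= (2 +_) [ i ]%= suc          ≡⟨ []%=-∘ t i ⟩
    t [ i ]%= (3 +_)                      ⟶⟨ fire-both t i ⟩
    t [ next i ]%= suc [ prev i ]%= suc   ⟶⟨ fire-sink (t [ next i ]%= suc) (prev i) h₂′ ⟩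
    t [ next i ]%= suc                    ⟶⟨ fire-sink t (next i) h₁ ⟩
    t                                     ∎)
    where
    open StarReasoning Topple
    h₂′ : 2 ≤ lookup (t [ next i ]%= suc) (prev i)
    h₂′ = subst (2 ≤_) (sym (lookup∘updateAt′ (prev i) (next i) (next≢prev i ∘ sym) t)) h₂

  -- The grain added at next (next a) travels counterclockwise and fills the hole at a.
  returns-to-ones : ∀ {t} a → (∀ j → lookup t j ≡ 1) →
                    ChainStep (t [ a ]≔ 0 [ next a ]%= suc [ next (next a) ]%= suc) t
  returns-to-ones {t} a ones = addGrain-then-topple c st (begin
    t₀ [ b ]%= suc [ c ]%= suc [ c ]%= suc ≡⟨ []%=-∘ (t₀ [ b ]%= suc) c ⟩
    t₀ [ b ]%= suc [ c ]%= (2 +_)          ⟶⟨ fire-prev (t₀ [ b ]%= suc) c (≤-reflexive (sym t₀ᵇc)) ⟩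
    t₀ [ b ]%= suc [ prev c ]%= suc        ≡⟨ cong (t₀ [ b ]%= suc [_]%= suc) (prev-next b) ⟩
    t₀ [ b ]%= suc [ b ]%= suc             ≡⟨ []%=-∘ t₀ b ⟩
    t₀ [ b ]%= (2 +_)                      ⟶⟨ fire-prev t₀ b (≤-reflexive (sym t₀b)) ⟩
    t₀ [ prev b ]%= suc                    ≡⟨ cong (t₀ [_]%= suc) (prev-next a) ⟩
    t₀ [ a ]%= suc                         ≡⟨ []%=-∘ t a ⟩
    t [ a ]≔ 1                             ≡⟨ cong (t [ a ]≔_) (sym (ones a)) ⟩
    t [ a ]≔ lookup t a                    ≡⟨ []≔-lookup t a ⟩
    t                                      ∎)
    where
    open StarReasoning Topple
    b = next a
    c = next b
    t₀ = t [ a ]≔ 0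
    st : Stable t
    st j = subst (_< 3) (sym (ones j)) (s≤s (s≤s z≤n))
    t₀b : lookup t₀ b ≡ 1
    t₀b = trans (lookup∘updateAt′ b a (next≢ a) t) (ones b)
    t₀ᵇc : lookup (t₀ [ b ]%= suc) c ≡ 1
    t₀ᵇc = trans (lookup∘updateAt′ c b (next≢ b) t₀) (trans (lookup∘updateAt′ c a (next²≢ a) t) (ones c))

  -- Recurrence

  full : Config N
  full = replicate N 2

  Stable⇒≤ᶜfull : (c : Config N) → Stable c → c ≤ᶜ full
  Stable⇒≤ᶜfull c st i = subst (lookup c i ≤_) (sym (lookup-replicate i 2)) (s≤s⁻¹ (st i))

  full-oriented : Oriented full
  full-oriented = oriented (λ _ → true) λ k → subst (1 ≤_) (sym (lookup-replicate k 2)) (s≤s z≤n)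

  full-or-deficient : ∀ {c} → Stable c → c ≡ full ⊎ ∃ λ y → lookup c y < 2
  full-or-deficient {c} st with any? (λ y → lookup c y <? 2)
  ... | yes deficient = inj₂ deficient
  ... | no  none      = inj₁ (lookup-ext λ y → trans (≤-antisym (s≤s⁻¹ (st y)) (≮⇒≥ (λ lt → none (y , lt))))
                                                 (sym (lookup-replicate y 2)))

  ascent-to-full : (P : Config N → Set) (R : Config N → Config N → Set) → (∀ {c} → P c → Stable c) →
                   (∀ {c} → P c → c ≡ full ⊎ ∃ λ c′ → P c′ × sum c < sum c′ × R c c′) →
                   ∀ {c} → P c → Star R c full
  ascent-to-full P R stable step {c} p = go (sum full) p (m≤m+n (sum full) (sum c))
    where
    go : ∀ fuel {c} → P c → sum full ≤ fuel + sum c → Star R c full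
    go fuel p bound with step p
    go _          p bound | inj₁ refl = ε
    go zero       p bound | inj₂ (c′ , p′ , grows , _) =
      contradiction (≤-trans (sum-mono-≤ᶜ {xs = c′} {full} (Stable⇒≤ᶜfull c′ (stable p′))) bound) (<⇒≱ grows)
    go (suc fuel) {c} p bound | inj₂ (c′ , p′ , grows , r) =
      r ◅ go fuel p′ (≤-trans bound (subst (_≤ fuel + sum c′) (+-suc fuel (sum c)) (+-monoʳ-≤ fuel grows)))

  reach-full : {c : Config N} → Stable c → Star ChainStep c full
  reach-full = ascent-to-full Stable ChainStep (λ st → st) add-below-two
    where
    add-below-two : ∀ {c} → Stable c → c ≡ full ⊎ ∃ λ c′ → Stable c′ × sum c < sum c′ × ChainStep c c′
    add-below-two {c} st with full-or-deficient st
    ... | inj₁ c≡full     = inj₁ c≡full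
    ... | inj₂ (y , y<2) = inj₂ (c [ y ]%= suc , st′ , grows , addGrain-then-topple y st′ ε)
      where
      st′ : Stable (c [ y ]%= suc)
      st′ = Stable-updateAt c y suc (s≤s y<2) st
      grows : sum c < sum (c [ y ]%= suc)
      grows = subst (sum c <_) (trans (+-comm 1 (sum c)) (sym (sum-updateAt-+ c y 1))) ≤-refl

  Predecessor : Config N → Set
  Predecessor t = ∃ λ t′ → (Stable t′ × Oriented t′) × sum t < sum t′ × ChainStep t′ t

  predecessor-raising : ∀ {t} i k → 1 ≤ k → k + lookup t i < 3 → Stable t → Oriented t →
                        ChainStep (t [ i ]%= (k +_)) t → Predecessor t
  predecessor-raising {t} i k k≥1 small st ot step =
    t [ i ]%= (k +_)
    , (Stable-updateAt t i (k +_) small st , Oriented-mono {c = t} (≤ᶜ-updateAt t i (λ x → m≤n+m x k)) ot)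
    , grows , step
    where
    grows : sum t < sum (t [ i ]%= (k +_))
    grows = subst (sum t <_) (sym (sum-updateAt-+ t i k)) (m<m+n (sum t) k≥1)

  predecessor-of-ones : ∀ {t} → Vertex → (∀ j → lookup t j ≡ 1) → Predecessor t
  predecessor-of-ones {t} a ones = t′ , (st′ , oriented o bound) , grows , returns-to-ones a ones
    where
    b = next a
    c = next b
    t₀ = t [ a ]≔ 0
    t₁ = t₀ [ b ]%= suc
    t′ = t₁ [ c ]%= suc
    t₀b≡1 : lookup t₀ b ≡ 1
    t₀b≡1 = trans (lookup∘updateAt′ b a (next≢ a) t) (ones b)
    t₁c≡1 : lookup t₁ c ≡ 1
    t₁c≡1 = trans (lookup∘updateAt′ c b (next≢ b) t₀) (trans (lookup∘updateAt′ c a (next²≢ a) t) (ones c))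
    st′ : Stable t′
    st′ = Stable-updateAt t₁ c suc (subst (λ x → suc x < 3) (sym t₁c≡1) ≤-refl)
            (Stable-updateAt t₀ b suc (subst (λ x → suc x < 3) (sym t₀b≡1) ≤-refl)
              (Stable-updateAt t a (λ _ → 0) (s≤s z≤n) (λ j → subst (_< 3) (sym (ones j)) (s≤s (s≤s z≤n)))))
    t′b≡2 : lookup t′ b ≡ 2
    t′b≡2 = trans (lookup∘updateAt′ b c (next≢ b ∘ sym) t₁) (trans (lookup∘updateAt b t₀) (cong suc t₀b≡1))
    t₀≤t′ : t₀ ≤ᶜ t′
    t₀≤t′ k = ≤-trans (≤ᶜ-updateAt t₀ b n≤1+n k) (≤ᶜ-updateAt t₁ c n≤1+n k)
    o : Orientation N
    o k = does (k ≟ᶠ a)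
    bound : ∀ k → inDegree o k ≤ lookup t′ k
    bound k = bound′ k (k ≟ᶠ a) (k ≟ᶠ b)
      where
      bound′ : ∀ k → Dec (k ≡ a) → Dec (k ≡ b) → inDegree o k ≤ lookup t′ k
      bound′ k (yes refl) _
        rewrite dec-false (prev k ≟ᶠ k) (prev≢ k) | dec-true (k ≟ᶠ k) refl = z≤n
      bound′ k (no _) (yes refl) = subst (inDegree o k ≤_) (sym t′b≡2) (inDegree≤2 o k)
      bound′ k (no k≢a) (no k≢b)
        rewrite dec-false (prev k ≟ᶠ a) (k≢b ∘ prev≡⇒≡next)
              | dec-false (k ≟ᶠ a) k≢a
        = ≤-trans (≤-reflexive (sym (trans (lookup∘updateAt′ k a k≢a t) (ones k)))) (t₀≤t′ k)
    grows : sum t < sum t′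
    grows = subst (sum t <_) (sym sum≡) (m<m+n (sum t) (s≤s z≤n))
      where
      open ≡-Reasoning
      sum≡ : sum t′ ≡ sum t + 1
      sum≡ = begin
        sum t′          ≡⟨ sum-updateAt-+ t₁ c 1 ⟩
        sum t₁ + 1      ≡⟨ cong (_+ 1) (sum-updateAt-+ t₀ b 1) ⟩
        sum t₀ + 1 + 1  ≡⟨ cong (λ x → sum t₀ + x + 1) (ones a) ⟨
        sum t₀ + lookup t a + 1 ≡⟨ cong (_+ 1) (sum-updateAt t a (λ _ → 0)) ⟩
        sum t + 0 + 1   ≡⟨ cong (_+ 1) (+-identityʳ (sum t)) ⟩
        sum t + 1       ∎

  -- Walking clockwise from a zero, the edges keep pointing forward through vertices holding one grain,
  -- until they reach a vertex holding two.
  two-after-zero : ∀ {t z} → Stable t → Oriented t → lookup t z ≡ 0 →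
                   lookup t (next z) ≡ 2 ⊎ ∃ λ k → lookup t k ≡ 1 × lookup t (next k) ≡ 2
  two-after-zero {t} {z} st (oriented o o≤t) tz≡0 = found (boundary Run? Run-z ¬Run-prev-z)
    where
    Run : Vertex → Set
    Run k = o k ≡ true × (k ≡ z ⊎ lookup t k ≡ 1)
    Run? : Decidable Run
    Run? k = (o k ≟ᵇ true) ×-dec ((k ≟ᶠ z) ⊎-dec (lookup t k ≟ 1))
    source : o (prev z) ≡ false × o z ≡ true
    source = inDegree≡0 o z (subst (inDegree o z ≤_) tz≡0 (o≤t z))
    Run-z : Run z
    Run-z = proj₂ source , inj₁ refl
    ¬Run-prev-z : ¬ Run (prev z)
    ¬Run-prev-z (forward , _) = contradiction (trans (sym forward) (proj₁ source)) λ ()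
    found : (∃ λ w → Run w × ¬ Run (next w)) → lookup t (next z) ≡ 2 ⊎ ∃ λ k → lookup t k ≡ 1 × lookup t (next k) ≡ 2
    found (w , (ow , w≡z⊎tw≡1) , ¬Run-next-w) =
      Sum.map (λ w≡z → subst (λ x → lookup t (next x) ≡ 2) w≡z tnw≡2) (λ tw≡1 → w , tw≡1 , tnw≡2) w≡z⊎tw≡1
      where
      incoming : o (prev (next w)) ≡ true
      incoming = trans (cong o (prev-next w)) ow
      not-below : ¬ lookup t (next w) < 2
      not-below (s≤s tnw≤1) = ¬Run-next-w
        ( inDegree≤1 o (next w) incoming (≤-trans (o≤t (next w)) tnw≤1)
        , inj₂ (≤-antisym tnw≤1 (≤-trans (inDegree≥1 o (next w) incoming) (o≤t (next w)))))
      tnw≡2 : lookup t (next w) ≡ 2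
      tnw≡2 = ≤-antisym (s≤s⁻¹ (st (next w))) (≮⇒≥ not-below)

  predecessor : ∀ {t} → Stable t → Oriented t → ∃ (λ y → lookup t y < 2) → Predecessor t
  predecessor {t} st ot (y , y<2) with any? (λ x → lookup t x ≟ 2)
  ... | yes (x , tx≡2) = after-two (boundary (λ k → lookup t k ≟ 2) tx≡2 (<⇒≢ y<2))
    where
    after-two : (∃ λ w → lookup t w ≡ 2 × lookup t (next w) ≢ 2) → Predecessor t
    after-two (w , tw≡2 , tz≢2) = after-two′ (zero-or-one (st z) tz≢2)
      where
      z = next w
      tpz≡2 : lookup t (prev z) ≡ 2
      tpz≡2 = trans (cong (lookup t) (prev-next w)) tw≡2
      after-two′ : lookup t z ≡ 0 ⊎ lookup t z ≡ 1 → Predecessor t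
      after-two′ (inj₂ tz≡1) = predecessor-raising z 1 ≤-refl (subst (λ v → 1 + v < 3) (sym tz≡1) ≤-refl) st ot
                                 (returns-via-prev z st (≤-reflexive (sym tz≡1)) (≤-reflexive (sym tpz≡2)))
      after-two′ (inj₁ tz≡0) with two-after-zero st ot tz≡0
      ... | inj₁ tnz≡2 = predecessor-raising z 2 (s≤s z≤n) (subst (λ v → 2 + v < 3) (sym tz≡0) ≤-refl) st ot
                           (returns-via-both z st (≤-reflexive (sym tnz≡2)) (≤-reflexive (sym tpz≡2)))
      ... | inj₂ (k , tk≡1 , tnk≡2) = predecessor-raising k 1 ≤-refl (subst (λ v → 1 + v < 3) (sym tk≡1) ≤-refl) st ot
                                        (returns-via-next k st (≤-reflexive (sym tk≡1)) (≤-reflexive (sym tnk≡2)))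
  ... | no no-two with any? (λ x → lookup t x ≟ 0)
  ...   | yes (z , tz≡0) = contradiction (two-after-zero st ot tz≡0) λ
    { (inj₁ tnz≡2)           → no-two (next z , tnz≡2)
    ; (inj₂ (k , _ , tnk≡2)) → no-two (next k , tnk≡2) }
  ...   | no no-zero = predecessor-of-ones y λ j →
    Sum.[ (λ tj≡0 → contradiction (j , tj≡0) no-zero) , id ]′ (zero-or-one (st j) (λ tj≡2 → no-two (j , tj≡2)))

  full-reaches : ∀ {t} → Stable t → Oriented t → Star ChainStep full t
  full-reaches st ot =
    reverse id (ascent-to-full (λ t → Stable t × Oriented t) (flip ChainStep) proj₁ descend (st , ot))
    where
    descend : ∀ {t} → Stable t × Oriented t → t ≡ full ⊎ Predecessor t
    descend (st , ot) = Sum.map₂ (predecessor st ot) (full-or-deficient st)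

  Recurrent⇒Oriented : ∀ {c} → Recurrent c → Oriented c
  Recurrent⇒Oriented (st , returns) = Oriented-chain (returns full (reach-full st)) full-oriented

  Oriented⇒Recurrent : ∀ {c} → Stable c → Oriented c → Recurrent c
  Oriented⇒Recurrent st oc = st , λ d c⇝d → reach-full (Stable-chain c⇝d st) ◅◅ full-reaches st oc

  -- The map m

  ZeroOnes : Config N → Vertex → Vertex → Set
  ZeroOnes c j i = lookup c j ≡ 0 × (∀ l → T (inOpen j i l) → lookup c l ≡ 1)

  AfterZeroOnes : Config N → Vertex → Set
  AfterZeroOnes c i = ∃ λ j → ZeroOnes c j i

  -- The second half of cfm?, verbatim: m unfolds to it.
  afterZeroOnes? : (c : Config N) (i : Vertex) → Dec (AfterZeroOnes c i)
  afterZeroOnes? c i = any? (λ j → (lookup c j ≟ 0) ×-dec all? (λ l → T? (inOpen j i l) →-dec (lookup c l ≟ 1)))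

  module _ (c : Config N) (j k : Vertex) where

    ZeroOnes-next⁻ : ZeroOnes c j (next k) → k ≡ j ⊎ (lookup c k ≡ 1 × ZeroOnes c j k)
    ZeroOnes-next⁻ (cj≡0 , ones) with k ≟ᶠ j
    ... | yes k≡j = inj₁ k≡j
    ... | no  k≢j =
      inj₂ (ones k (inOpen-next⁺ j k k k≢j (inj₂ refl)) , cj≡0 , λ l l∈ → ones l (inOpen-next⁺ j k l k≢j (inj₁ l∈)))

    ZeroOnes-next⁺ : ZeroOnes c j k → lookup c k ≡ 1 → ZeroOnes c j (next k)
    ZeroOnes-next⁺ (cj≡0 , ones) ck≡1 = cj≡0 , λ l l∈ →
      Sum.[ ones l , (λ l≡k → trans (cong (lookup c) l≡k) ck≡1) ] (proj₂ (inOpen-next⁻ j k l l∈))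

  module _ (c : Config N) (k : Vertex) where

    AfterZeroOnes-next⁻ : AfterZeroOnes c (next k) → lookup c k ≡ 0 ⊎ (lookup c k ≡ 1 × AfterZeroOnes c k)
    AfterZeroOnes-next⁻ (j , zo) =
      Sum.map (λ k≡j → trans (cong (lookup c) k≡j) (proj₁ zo)) (Product.map₂ (j ,_)) (ZeroOnes-next⁻ c j k zo)

    AfterZeroOnes-next⁺ : lookup c k ≡ 0 ⊎ (lookup c k ≡ 1 × AfterZeroOnes c k) → AfterZeroOnes c (next k)
    AfterZeroOnes-next⁺ (inj₁ ck≡0)             = k , ck≡0 , λ l l∈ → contradiction refl (proj₁ (inOpen-next⁻ k k l l∈))
    AfterZeroOnes-next⁺ (inj₂ (ck≡1 , j , zo)) = j , ZeroOnes-next⁺ c j k zo ck≡1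

    AfterZeroOnes-next-one : lookup c k ≡ 1 → AfterZeroOnes c (next k) ⇔ AfterZeroOnes c k
    AfterZeroOnes-next-one ck≡1 = mk⇔
      (Sum.[ (λ ck≡0 → contradiction (trans (sym ck≡0) ck≡1) λ ()) , proj₂ ] ∘ AfterZeroOnes-next⁻)
      (λ a → AfterZeroOnes-next⁺ (inj₂ (ck≡1 , a)))

    AfterZeroOnes-next-two : lookup c k ≡ 2 → ¬ AfterZeroOnes c (next k)
    AfterZeroOnes-next-two ck≡2 = Sum.[ (λ ck≡0 → contradiction (trans (sym ck≡0) ck≡2) λ ())
                                      , (λ (ck≡1 , _) → contradiction (trans (sym ck≡1) ck≡2) λ ()) ] ∘ AfterZeroOnes-next⁻

  -- From the zero, the orientation is forced to point clockwise along the ones, hence into i.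
  zero-not-afterZeroOnes : ∀ {c i} → Oriented c → lookup c i ≡ 0 → ¬ AfterZeroOnes c i
  zero-not-afterZeroOnes {c} {i} (oriented o o≤c) ci≡0 (j , zo) =
    contradiction (≤-trans (inDegree≥1 o i forward-into-i) (subst (inDegree o i ≤_) ci≡0 (o≤c i))) λ ()
    where
    zero-forward : ∀ {k} → lookup c k ≡ 0 → o k ≡ true
    zero-forward {k} ck≡0 = proj₂ (inDegree≡0 o k (subst (inDegree o k ≤_) ck≡0 (o≤c k)))
    Forward : Vertex → Set
    Forward k = ZeroOnes c j (next k) → o k ≡ true
    step : ∀ k → Forward k → Forward (next k)
    step k forward zo′ with ZeroOnes-next⁻ c j (next k) zo′
    ... | inj₁ nk≡j          = zero-forward (trans (cong (lookup c) nk≡j) (proj₁ zo′))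
    ... | inj₂ (cnk≡1 , zo″) = inDegree≤1 o (next k) (trans (cong o (prev-next k)) (forward zo″))
                                 (subst (inDegree o (next k) ≤_) cnk≡1 (o≤c (next k)))
    forward-into-i : o (prev i) ≡ true
    forward-into-i = cycle-induction Forward (λ zo′ → zero-forward (proj₁ zo′)) step (prev i)
                       (subst (ZeroOnes c j) (sym (next-prev i)) zo)

  m-lookup : (c : Config N) (i : Vertex) →
             lookup (m c) i ≡ (if does (lookup c i ≟ 0) then 0 else if does (cfm? c i) then 2 else 1)
  m-lookup c i = lookup∘tabulate (λ i → if does (lookup c i ≟ 0) then 0 else if does (cfm? c i) then 2 else 1) i

  m-≤ᶜ : (c : Config N) → m c ≤ᶜ c
  m-≤ᶜ c i = subst (_≤ lookup c i) (sym (m-lookup c i)) (bound (lookup c i ≟ 0) (cfm? c i))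
    where
    bound : (zero? : Dec (lookup c i ≡ 0)) (cfm : Dec (CyclicallyFirstMaximal c i)) →
            (if does zero? then 0 else if does cfm then 2 else 1) ≤ lookup c i
    bound (yes _)    _              = z≤n
    bound (no  _)    (yes (ci≡2 , _)) = ≤-reflexive (sym ci≡2)
    bound (no  ci≢0) (no  _)        = n≢0⇒n>0 ci≢0

  mOrientation : Config N → Orientation N
  mOrientation c k = does (afterZeroOnes? c (next k))

  inDegree-mOrientation : (c : Config N) (i : Vertex) →
    inDegree (mOrientation c) i ≡ bit (does (afterZeroOnes? c i)) + bit (not (does (afterZeroOnes? c (next i))))
  inDegree-mOrientation c i =
    cong (λ x → bit (does (afterZeroOnes? c x)) + bit (not (does (afterZeroOnes? c (next i))))) (next-prev i)

  m-at-zero : ∀ c i → Oriented c → lookup c i ≡ 0 → lookup (m c) i ≡ inDegree (mOrientation c) i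
  m-at-zero c i oc ci≡0
    rewrite m-lookup c i | inDegree-mOrientation c i | ci≡0
          | dec-false (afterZeroOnes? c i) (zero-not-afterZeroOnes oc ci≡0)
          | dec-true (afterZeroOnes? c (next i)) (AfterZeroOnes-next⁺ c i (inj₁ ci≡0))
    = refl

  m-at-one : ∀ c i → lookup c i ≡ 1 → lookup (m c) i ≡ inDegree (mOrientation c) i
  m-at-one c i ci≡1
    rewrite m-lookup c i | inDegree-mOrientation c i | ci≡1
          | does-⇔ (AfterZeroOnes-next-one c i ci≡1) (afterZeroOnes? c (next i)) (afterZeroOnes? c i)
    = sym (bit+bit-not (does (afterZeroOnes? c i)))

  m-at-two : ∀ c i → lookup c i ≡ 2 → lookup (m c) i ≡ inDegree (mOrientation c) i
  m-at-two c i ci≡2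
    rewrite m-lookup c i | inDegree-mOrientation c i | ci≡2
          | dec-false (afterZeroOnes? c (next i)) (AfterZeroOnes-next-two c i ci≡2)
    = two (does (afterZeroOnes? c i))
    where
    two : ∀ x → (if x then 2 else 1) ≡ bit x + 1
    two true  = refl
    two false = refl

  m≡inDegrees : ∀ {c} → Stable c → Oriented c → m c ≡ inDegrees (mOrientation c)
  m≡inDegrees {c} st oc = lookup-ext λ i → trans (by-value i) (sym (lookup∘tabulate (inDegree (mOrientation c)) i))
    where
    by-value : ∀ i → lookup (m c) i ≡ inDegree (mOrientation c) i
    by-value i with lookup c i ≟ 2
    ... | yes ci≡2 = m-at-two c i ci≡2
    ... | no  ci≢2 = Sum.[ m-at-zero c i oc , m-at-one c i ]′ (zero-or-one (st i) ci≢2)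

  inDegrees-minimalRecurrent : (o : Orientation N) → MinimalRecurrent (inDegrees o)
  inDegrees-minimalRecurrent o = Oriented⇒Recurrent stable (oriented o λ k → ≤-reflexive (sym (lookup-inDegrees k))) , minimal
    where
    lookup-inDegrees : ∀ k → lookup (inDegrees o) k ≡ inDegree o k
    lookup-inDegrees = lookup∘tabulate (inDegree o)
    stable : Stable (inDegrees o)
    stable k = subst (_< 3) (sym (lookup-inDegrees k)) (s≤s (inDegree≤2 o k))
    minimal : ∀ d → Recurrent d → d ≤ᶜ inDegrees o → d ≡ inDegrees o
    minimal d rd d≤ =
      ≤ᶜ∧sum≤⇒≡ d≤ (subst (_≤ sum d) (sym (sum-inDegrees o)) (Oriented⇒size≥ (Recurrent⇒Oriented rd)))

  m-minimalRecurrent : (c : Config N) → Recurrent c → MinimalRecurrent (m c)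
  m-minimalRecurrent c rc@(st , _) =
    subst MinimalRecurrent (sym (m≡inDegrees st (Recurrent⇒Oriented rc))) (inDegrees-minimalRecurrent (mOrientation c))

  m-fixes-minimal : (c : Config N) → MinimalRecurrent c → m c ≡ c
  m-fixes-minimal c (rc , minimal) = minimal (m c) (proj₁ (m-minimalRecurrent c rc)) (m-≤ᶜ c)

  size-m : (c : Config N) → Recurrent c → size (m c) ≡ N
  size-m c rc@(st , _) = trans (cong sum (m≡inDegrees st (Recurrent⇒Oriented rc))) (sum-inDegrees (mOrientation c))

  level≡size-N : (c : Config N) → level c ≡ ℤ.+ size c ℤ.- ℤ.+ N
  level≡size-N c = begin
    ℤ.+ (sum c + N) ℤ.- ℤ.+ (2 * N) ≡⟨ [+m]-[+n]≡m⊖n (sum c + N) (2 * N) ⟩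
    (sum c + N) ⊖ (2 * N)     ≡⟨ cong₂ _⊖_ (+-comm (sum c) N) (cong (N +_) (+-identityʳ N)) ⟩
    (N + sum c) ⊖ (N + N)     ≡⟨ +-cancelˡ-⊖ N (sum c) N ⟩
    sum c ⊖ N                 ≡⟨ [+m]-[+n]≡m⊖n (sum c) N ⟨
    ℤ.+ sum c ℤ.- ℤ.+ N        ∎
    where open ≡-Reasoning

open import Data.Integer using (+_; _-_)

proposition3p6 : (n : ℕ) → 3 ≤ n →
    ((c : Config n) → Recurrent c → MinimalRecurrent (m c))
  × ((d : Config n) → MinimalRecurrent d → Σ (Config n) (λ c → Recurrent c × m c ≡ d))
  × ((c : Config n) → MinimalRecurrent c → m c ≡ c)
  × ((c : Config n) → Recurrent c → level c ≡ + size c - + size (m c))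
proposition3p6 (suc (suc (suc n))) _ =
    m-minimalRecurrent
  , (λ d md → d , proj₁ md , m-fixes-minimal d md)
  , m-fixes-minimal
  , λ c rc → trans (level≡size-N c) (cong (λ k → + size c - + k) (sym (size-m c rc)))
  where open Wheel n
proposition3p6 1 (s≤s ())
proposition3p6 2 (s≤s (s≤s ()))
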